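{- Let $G$ be a graph that has a min-max clique covering with simple intersection, and suppose its compressed cliques graph $\mathcal{C}(G)$ has no induced cycles other than $K_3$. Then $Z_+(G)=|V(G)|-\mathrm{cc}(G)$.
   Context: A clique is a set of vertices inducing a complete subgraph; maximal if no vertex can be added. A clique covering is a set of cliques such that every edge lies inside one of them; $\mathrm{cc}(G)$ is the minimum size of a clique covering; a min-max clique covering is one of size $\mathrm{cc}(G)$ all of whose cliques are maximal. A covering $\{C_1,\dots,C_\ell\}$ has simple intersection if no vertex lies in three distinct $C_i$. For such a covering define, for $i\neq j$, $C_{i,j}=C_i\cap C_j$, and $C_{i,i}=C_i\setminus\bigcup_{j\neq i}C_j$. The compressed cliques graph $\mathcal{C}(G)$ has one vertex $v_{i,j}$ for each nonempty $C_{i,j}$ (unordered pairs, $i=j$ allowed), distinct $v_{i,j},v_{i',j'}$ adjacent iff $\{i,j\}\cap\{i',j'\}\neq\emptyset$. Positive zero forcing: a set $B$ of vertices is coloured black, the rest white; if $W_1,\dots,W_k$ are the vertex sets of the components of $G-B$ ($B$ the current black set), $u\in B$, and $w$ is the only white neighbour of $u$ in $G[W_i\cup B]$, then $w$ may be coloured black. $S$ is a positive zero forcing set if starting from $S$ black all vertices eventually become black; $Z_+(G)$ is the minimum size of such a set. -}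

module Defs where

open import Data.Nat using (ℕ; suc; _≤_; _∸_)
open import Data.Fin using (Fin; toℕ)
open import Data.Fin.Subset using (Subset; _∈_; _∉_; ⁅_⁆; _∪_; ∣_∣)
open import Data.Empty using (⊥)
open import Data.Bool using (Bool; true; false)
open import Data.Product using (Σ; ∃; ∃-syntax; _×_; _,_; proj₁; proj₂)
open import Data.Sum using (_⊎_)
open import Relation.Binary.PropositionalEquality using (_≡_; _≢_)
open import Relation.Nullary using (¬_)
open import Function.Bundles using (_⇔_)

record Graph : Set where
  field
    n      : ℕ
    adj    : Fin n → Fin n → Bool
    sym    : ∀ u v → adj u v ≡ adj v u
    irrefl : ∀ v → adj v v ≡ false

open Graph public

Adj : (G : Graph) → Fin (n G) → Fin (n G) → Set
Adj G u v = adj G u v ≡ true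

IsClique : (G : Graph) → Subset (n G) → Set
IsClique G C = ∀ u v → u ∈ C → v ∈ C → u ≢ v → Adj G u v

IsMaximalClique : (G : Graph) → Subset (n G) → Set
IsMaximalClique G C = IsClique G C × (∀ w → w ∉ C → ¬ IsClique G (⁅ w ⁆ ∪ C))

IsCliqueCovering : (G : Graph) {ℓ : ℕ} → (Fin ℓ → Subset (n G)) → Set
IsCliqueCovering G {ℓ} C =
  (∀ i → IsClique G (C i)) ×
  (∀ u v → Adj G u v → ∃[ i ] (u ∈ C i × v ∈ C i))

IsCliqueCoverNumber : (G : Graph) → ℕ → Set
IsCliqueCoverNumber G k =
  (Σ (Fin k → Subset (n G)) λ C → IsCliqueCovering G C) ×
  (∀ m (C : Fin m → Subset (n G)) → IsCliqueCovering G C → k ≤ m)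

IsMinMaxCliqueCovering : (G : Graph) {ℓ : ℕ} → (Fin ℓ → Subset (n G)) → Set
IsMinMaxCliqueCovering G {ℓ} C =
  IsCliqueCovering G C × IsCliqueCoverNumber G ℓ × (∀ i → IsMaximalClique G (C i))

SimpleIntersection : (G : Graph) {ℓ : ℕ} → (Fin ℓ → Subset (n G)) → Set
SimpleIntersection G {ℓ} C =
  ∀ v (i j k : Fin ℓ) → i ≢ j → j ≢ k → i ≢ k →
    v ∈ C i → v ∈ C j → v ∈ C k → ⊥

-- v ∈ C_{i,j}: for i ≠ j, C_i ∩ C_j; for i = j, C_i minus the other cliques
InPart : (G : Graph) {ℓ : ℕ} → (Fin ℓ → Subset (n G)) → Fin ℓ → Fin ℓ → Fin (n G) → Set
InPart G {ℓ} C i j v =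
  (i ≡ j → v ∈ C i × (∀ k → k ≢ i → v ∉ C k)) ×
  (i ≢ j → v ∈ C i × v ∈ C j)

-- vertices of 𝒞(G): unordered pairs {i,j} (represented with toℕ i ≤ toℕ j)
-- with C_{i,j} nonempty
IsCVertex : (G : Graph) {ℓ : ℕ} → (Fin ℓ → Subset (n G)) → Fin ℓ × Fin ℓ → Set
IsCVertex G C (i , j) = toℕ i ≤ toℕ j × ∃[ v ] InPart G C i j v

CAdj : {ℓ : ℕ} → Fin ℓ × Fin ℓ → Fin ℓ × Fin ℓ → Set
CAdj (i , j) (i' , j') =
  ¬ (i ≡ i' × j ≡ j') ×
  (i ≡ i' ⊎ i ≡ j' ⊎ j ≡ i' ⊎ j ≡ j')

CycleAdj : (k : ℕ) → Fin k → Fin k → Set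
CycleAdj k a b =
  suc (toℕ a) ≡ toℕ b ⊎ suc (toℕ b) ≡ toℕ a ⊎
  (toℕ a ≡ 0 × suc (toℕ b) ≡ k) ⊎ (toℕ b ≡ 0 × suc (toℕ a) ≡ k)

InducedCycle : {V : Set} → (V → Set) → (V → V → Set) → (k : ℕ) → Set
InducedCycle {V} Vert E k =
  Σ (Fin k → V) λ f →
    (∀ a → Vert (f a)) ×
    (∀ a b → f a ≡ f b → a ≡ b) ×
    (∀ a b → E (f a) (f b) ⇔ CycleAdj k a b)

-- no induced cycles other than K₃ (cycles have length ≥ 3)
NoInducedCycleExceptK3 : {V : Set} → (V → Set) → (V → V → Set) → Set
NoInducedCycleExceptK3 Vert E = ∀ k → 4 ≤ k → ¬ InducedCycle Vert E k

data WhiteConn (G : Graph) (B : Subset (n G)) (w : Fin (n G)) : Fin (n G) → Set where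
  here : w ∉ B → WhiteConn G B w w
  step : ∀ {x y} → WhiteConn G B w x → y ∉ B → Adj G x y → WhiteConn G B w y

-- u (black) may force w: w is the only white neighbour of u in G[W ∪ B],
-- W the component of G - B containing w
CanForce : (G : Graph) → Subset (n G) → Fin (n G) → Fin (n G) → Set
CanForce G B u w =
  u ∈ B × w ∉ B × Adj G u w ×
  (∀ w' → w' ∉ B → Adj G u w' → WhiteConn G B w w' → w' ≡ w)

data Forces (G : Graph) (B : Subset (n G)) : Set where
  done  : (∀ v → v ∈ B) → Forces G B
  force : ∀ u w → CanForce G B u w → Forces G (⁅ w ⁆ ∪ B) → Forces G B

IsPZFSet : (G : Graph) → Subset (n G) → Set
IsPZFSet G S = Forces G S

IsPZFNumber : (G : Graph) → ℕ → Set
IsPZFNumber G z =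
  (Σ (Subset (n G)) λ S → IsPZFSet G S × ∣ S ∣ ≡ z) ×
  (∀ S → IsPZFSet G S → z ≤ ∣ S ∣)

-- Lower bound: if u forces w, pick a clique C i of the covering containing u and w. Every other
-- vertex of C i is adjacent to u and, if white, lies in the white component of w, so after the
-- force C i is entirely black. Each force thus fills a new clique, at most ℓ forces occur, and
-- every positive zero forcing set has at least n − ℓ vertices.
--
-- Upper bound: suppose every clique x has a rank, a forced vertex and a forcer in C x, the forced
-- vertex lying otherwise only in cliques of larger rank and the forcer only in cliques of smaller
-- rank. Then the n − ℓ vertices that are forced by no clique form a forcing set: in rank order,
-- the forcer of x is black and its only white neighbour is the forced vertex of x. Such an order
-- comes from peeling cliques off the clique intersection graph, which has no cycles of length ≥ 4
-- since the line graph of such a cycle is an induced cycle of 𝒞(G). The peeled clique x is the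
-- start of a maximal path, so it meets at most two remaining cliques, and these meet each other.
-- Its forced vertex is shared with a remaining clique; its forcer is shared with an already peeled
-- clique or is private, and private vertices exist by minimality and maximality of the covering
-- and simple intersection. Every remaining clique stays connected to an anchor clique with a
-- private vertex, and a clique is peeled without remaining neighbours only if it is such an anchor.

module Submission where

open import Defs hiding (sym)
open import Data.Bool using (true)
open import Data.Empty using (⊥; ⊥-elim)
open import Data.Fin using (Fin; zero; suc; toℕ; fromℕ; inject≤; punchIn; punchOut; _≟_)
import Data.Fin.Properties as Fin
open import Data.Fin.Properties using (any?; all?)
open import Data.Fin.Relation.Unary.Top using (view; ‵fromℕ; ‵inject₁)
open import Data.Fin.Subset
  using (Subset; _∈_; _∉_; _⊆_; _⊈_; _⊂_; _⊃_; ⁅_⁆; _∪_; _─_; _-_; ∁; ⊤; ∣_∣; inside; outside)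
open import Data.Fin.Subset.Induction using (⊂-wellFounded; ⊃-wellFounded)
open import Data.Fin.Subset.Properties
open import Data.Nat using (ℕ; zero; suc; _+_; _∸_; _≤_; _<_; z≤n; s≤s)
import Data.Nat.Properties as ℕ
open import Data.Product using (Σ; ∃; ∃-syntax; _×_; _,_; proj₁; proj₂; map₂)
open import Data.Sum using (_⊎_; inj₁; inj₂; [_,_]′)
open import Data.Vec using (_∷_; tabulate; here; there)
import Data.Vec.Properties as Vec
open import Function.Bundles using (_⇔_; mk⇔; Equivalence)
open import Induction.WellFounded using (Acc; acc)
open import Relation.Binary.PropositionalEquality
  using (_≡_; _≢_; refl; sym; trans; cong; cong₂; subst; subst₂; ≢-sym)
open import Relation.Nullary using (¬_; Dec; yes; no; does)
open import Relation.Nullary.Decidable using (decidable-stable; _×-dec_; _→-dec_; ¬?)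
open import Relation.Unary using (Pred; Decidable)
open import Level using (0ℓ)

private
  variable
    k m : ℕ

x∈p─q⇒x∉q : ∀ {x : Fin m} {p q : Subset m} → x ∈ p ─ q → x ∉ q
x∈p─q⇒x∉q {p = _ ∷ _} {outside ∷ _} here ()
x∈p─q⇒x∉q {p = _ ∷ _} {outside ∷ _} (there x∈) (there x∈q) = x∈p─q⇒x∉q x∈ x∈q
x∈p─q⇒x∉q {p = _ ∷ _} {inside ∷ _} (there x∈) (there x∈q) = x∈p─q⇒x∉q x∈ x∈q

x∈p-y⇒x≢y : ∀ {x y : Fin m} {p : Subset m} → x ∈ p - y → x ≢ y
x∈p-y⇒x≢y {y = y} x∈ refl = x∈p─q⇒x∉q x∈ (x∈⁅x⁆ y)

x∈p-y⇒x∈p : ∀ {x y : Fin m} {p : Subset m} → x ∈ p - y → x ∈ p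
x∈p-y⇒x∈p {y = y} {p} = p─q⊆p p ⁅ y ⁆

∣⁅x⁆∪p∣≤1+∣p∣ : ∀ (x : Fin m) (p : Subset m) → ∣ ⁅ x ⁆ ∪ p ∣ ≤ suc ∣ p ∣
∣⁅x⁆∪p∣≤1+∣p∣ zero (outside ∷ p) rewrite ∪-identityˡ p = ℕ.≤-refl
∣⁅x⁆∪p∣≤1+∣p∣ zero (inside ∷ p) rewrite ∪-identityˡ p = ℕ.n≤1+n _
∣⁅x⁆∪p∣≤1+∣p∣ (suc x) (outside ∷ p) = ∣⁅x⁆∪p∣≤1+∣p∣ x p
∣⁅x⁆∪p∣≤1+∣p∣ (suc x) (inside ∷ p) = s≤s (∣⁅x⁆∪p∣≤1+∣p∣ x p)

x∉p⇒p⊂⁅x⁆∪p : ∀ {x : Fin m} {p : Subset m} → x ∉ p → p ⊂ ⁅ x ⁆ ∪ p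
x∉p⇒p⊂⁅x⁆∪p {x = x} x∉p =
  (λ y∈p → x∈p∪q⁺ (inj₂ y∈p)) , x , x∈p∪q⁺ (inj₁ (x∈⁅x⁆ x)) , x∉p

select : {P : Pred (Fin m) 0ℓ} → Decidable P → Subset m
select P? = tabulate (λ x → does (P? x))

module _ {P : Pred (Fin m) 0ℓ} (P? : Decidable P) where

  ∈select⁻ : ∀ {x} → x ∈ select P? → P x
  ∈select⁻ {x} x∈ with P? x | trans (sym (Vec.lookup∘tabulate _ x)) (Vec.[]=⇒lookup x∈)
  ... | yes px | _ = px

  ∈select⁺ : ∀ {x} → P x → x ∈ select P?
  ∈select⁺ {x} px = Vec.lookup⇒[]= x _ (trans (Vec.lookup∘tabulate _ x) (lemma (P? x)))
    where
    lemma : (d : Dec (P x)) → does d ≡ true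
    lemma (yes _) = refl
    lemma (no ¬px) = ⊥-elim (¬px px)

image : (Fin k → Fin m) → Subset m
image f = select (λ y → any? (λ x → y ≟ f x))

∈image⁺ : ∀ (f : Fin k → Fin m) x → f x ∈ image f
∈image⁺ f x = ∈select⁺ (λ y → any? (λ x → y ≟ f x)) (x , refl)

∈image⁻ : ∀ (f : Fin k → Fin m) {y} → y ∈ image f → ∃[ x ] (y ≡ f x)
∈image⁻ f = ∈select⁻ (λ y → any? (λ x → y ≟ f x))

injective⇒≤∣image∣ : ∀ (f : Fin k → Fin m) → (∀ a b → f a ≡ f b → a ≡ b) → k ≤ ∣ image f ∣
injective⇒≤∣image∣ {zero} f f-inj = z≤n
injective⇒≤∣image∣ {suc k} f f-inj =
  ℕ.<-≤-trans (s≤s (injective⇒≤∣image∣ f∘suc (λ a b eq → Fin.suc-injective (f-inj _ _ eq))))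
    (p⊂q⇒∣p∣<∣q∣ (image-suc⊆ , f zero , ∈image⁺ f zero , f0∉))
  where
  f∘suc : Fin k → Fin _
  f∘suc x = f (suc x)
  image-suc⊆ : image f∘suc ⊆ image f
  image-suc⊆ y∈ with ∈image⁻ f∘suc y∈
  ... | x , refl = ∈image⁺ f (suc x)
  f0∉ : f zero ∉ image f∘suc
  f0∉ f0∈ with ∈image⁻ f∘suc f0∈
  ... | x , eq with f-inj zero (suc x) eq
  ... | ()

∃-minimal : {P : Pred (Fin k) 0ℓ} → Decidable P → (d : Fin k → ℕ) → ∃ P →
            ∃[ x ] (P x × ∀ y → d y < d x → ¬ P y)
∃-minimal {P = P} P? d (x , px) = go (d x) x ℕ.≤-refl px
  where
  go : ∀ t x → d x ≤ t → P x → ∃[ x ] (P x × ∀ y → d y < d x → ¬ P y)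
  go t x dx≤t px with any? (λ y → (d y ℕ.<? d x) ×-dec P? y)
  ... | no none = x , px , λ y dy<dx py → none (y , dy<dx , py)
  go zero x dx≤0 px | yes (y , dy<dx , _) = ⊥-elim (ℕ.n≮0 (ℕ.<-≤-trans dy<dx dx≤0))
  go (suc t) x dx≤t px | yes (y , dy<dx , py) =
    go t y (ℕ.≤-pred (ℕ.<-≤-trans dy<dx dx≤t)) py

next : ∀ {t} → Fin (suc t) → Fin (suc t)
next a with view a
... | ‵fromℕ = zero
... | ‵inject₁ b = suc b

IsNext : ∀ {t} → Fin (suc t) → Fin (suc t) → Set
IsNext {t} a b = suc (toℕ a) ≡ toℕ b ⊎ (toℕ b ≡ 0 × suc (toℕ a) ≡ suc t)

IsNext-next : ∀ {t} (a : Fin (suc t)) → IsNext a (next a)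
IsNext-next {t} a with view a
... | ‵fromℕ = inj₂ (refl , cong suc (Fin.toℕ-fromℕ t))
... | ‵inject₁ b = inj₁ (cong suc (Fin.toℕ-inject₁ b))

IsNext-functional : ∀ {t} {a b b′ : Fin (suc t)} → IsNext a b → IsNext a b′ → b ≡ b′
IsNext-functional (inj₁ e) (inj₁ e′) = Fin.toℕ-injective (trans (sym e) e′)
IsNext-functional (inj₂ (e , _)) (inj₂ (e′ , _)) = Fin.toℕ-injective (trans e (sym e′))
IsNext-functional {b = b} (inj₁ e) (inj₂ (_ , f)) =
  ⊥-elim (ℕ.<-irrefl (trans (sym e) f) (Fin.toℕ<n b))
IsNext-functional {b′ = b′} (inj₂ (_ , f)) (inj₁ e) =
  ⊥-elim (ℕ.<-irrefl (trans (sym e) f) (Fin.toℕ<n b′))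

IsNext⇒≡next : ∀ {t} {a b : Fin (suc t)} → IsNext a b → b ≡ next a
IsNext⇒≡next {a = a} ab = IsNext-functional ab (IsNext-next a)

next-injective : ∀ {t} {a b : Fin (suc t)} → next a ≡ next b → a ≡ b
next-injective {a = a} {b} eq with IsNext-next a | IsNext-next b
... | inj₁ e | inj₁ e′ =
  Fin.toℕ-injective (ℕ.suc-injective (trans e (trans (cong toℕ eq) (sym e′))))
... | inj₂ (_ , f) | inj₂ (_ , f′) = Fin.toℕ-injective (ℕ.suc-injective (trans f (sym f′)))
... | inj₁ e | inj₂ (g , _) with trans e (trans (cong toℕ eq) g)
...   | ()
next-injective {a = a} {b} eq | inj₂ (g , _) | inj₁ e with trans e (trans (cong toℕ (sym eq)) g)
...   | ()

next-≢ : ∀ {t} (a : Fin (2 + t)) → next a ≢ a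
next-≢ a eq with IsNext-next a
... | inj₁ e = ℕ.1+n≢n (trans e (cong toℕ eq))
... | inj₂ (g , f) with subst (λ z → suc z ≡ _) (trans (sym (cong toℕ eq)) g) f
...   | ()

next²-≢ : ∀ {t} (a : Fin (3 + t)) → next (next a) ≢ a
next²-≢ a eq with IsNext-next a | IsNext-next (next a)
... | inj₁ e | inj₁ e′ = ℕ.<-irrefl refl
  (subst (toℕ a <_) (trans (cong suc e) (trans e′ (cong toℕ eq))) (ℕ.m<n⇒m<1+n (ℕ.n<1+n _)))
... | inj₁ e | inj₂ (g , f)
  with subst (λ z → suc (suc z) ≡ _) (trans (sym (cong toℕ eq)) g) (trans (cong suc e) f)
...   | ()
next²-≢ a eq | inj₂ (g , f) | inj₁ e′
  with subst (λ z → suc (suc z) ≡ _) g (trans (cong suc (trans e′ (cong toℕ eq))) f)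
...   | ()
next²-≢ a eq | inj₂ (g , f) | inj₂ (g′ , _)
  with subst (λ z → suc z ≡ _) (trans (sym (cong toℕ eq)) g′) f
...   | ()

CycleAdj⇔next : ∀ {t} (a b : Fin (suc t)) → CycleAdj (suc t) a b ⇔ (b ≡ next a ⊎ a ≡ next b)
CycleAdj⇔next a b = mk⇔ to from
  where
  to : CycleAdj _ a b → b ≡ next a ⊎ a ≡ next b
  to (inj₁ e) = inj₁ (IsNext⇒≡next (inj₁ e))
  to (inj₂ (inj₁ e)) = inj₂ (IsNext⇒≡next (inj₁ e))
  to (inj₂ (inj₂ (inj₁ e))) = inj₂ (IsNext⇒≡next (inj₂ e))
  to (inj₂ (inj₂ (inj₂ e))) = inj₁ (IsNext⇒≡next (inj₂ e))
  from : b ≡ next a ⊎ a ≡ next b → CycleAdj _ a b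
  from (inj₁ refl) with IsNext-next a
  ... | inj₁ e = inj₁ e
  ... | inj₂ e = inj₂ (inj₂ (inj₂ e))
  from (inj₂ refl) with IsNext-next b
  ... | inj₁ e = inj₂ (inj₁ e)
  ... | inj₂ e = inj₂ (inj₂ (inj₁ e))

Adj-sym : (G : Graph) {u v : Fin (n G)} → Adj G u v → Adj G v u
Adj-sym G {u} {v} uv = trans (Graph.sym G v u) uv

Adj⇒≢ : (G : Graph) {u v : Fin (n G)} → Adj G u v → u ≢ v
Adj⇒≢ G {u} uv refl with trans (sym uv) (irrefl G u)
... | ()

clique-extend : (G : Graph) {K : Subset (n G)} {w : Fin (n G)} → IsClique G K →
                (∀ q → q ∈ K → q ≢ w → Adj G w q) → IsClique G (⁅ w ⁆ ∪ K)
clique-extend G {K} {w} K-clique w~ p q p∈ q∈ p≢q with x∈p∪q⁻ ⁅ w ⁆ K p∈ | x∈p∪q⁻ ⁅ w ⁆ K q∈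
... | inj₁ p∈w | inj₁ q∈w = ⊥-elim (p≢q (trans (x∈⁅y⁆⇒x≡y w p∈w) (sym (x∈⁅y⁆⇒x≡y w q∈w))))
... | inj₁ p∈w | inj₂ q∈K rewrite x∈⁅y⁆⇒x≡y w p∈w = w~ q q∈K (≢-sym p≢q)
... | inj₂ p∈K | inj₁ q∈w rewrite x∈⁅y⁆⇒x≡y w q∈w = Adj-sym G (w~ p p∈K p≢q)
... | inj₂ p∈K | inj₂ q∈K = K-clique p q p∈K q∈K p≢q

-- Clique coverings and positive zero forcing

record ForcingOrder (G : Graph) {ℓ : ℕ} (C : Fin ℓ → Subset (n G)) : Set where
  field
    rank : Fin ℓ → ℕ
    forced forcer : Fin ℓ → Fin (n G)
    forced∈ : ∀ x → forced x ∈ C x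
    forcer∈ : ∀ x → forcer x ∈ C x
    forcer≢forced : ∀ x → forcer x ≢ forced x
    forced-later : ∀ x m → m ≢ x → forced x ∈ C m → rank x < rank m
    forcer-earlier : ∀ x m → m ≢ x → forcer x ∈ C m → rank m < rank x

module CliqueCovering (G : Graph) {ℓ : ℕ} (C : Fin ℓ → Subset (n G))
                      (covering : IsCliqueCovering G C) where

  private
    clique : ∀ i → IsClique G (C i)
    clique = proj₁ covering

    covers : ∀ u v → Adj G u v → ∃[ i ] (u ∈ C i × v ∈ C i)
    covers = proj₂ covering

  unfilled? : (B : Subset (n G)) → Decidable (λ i → C i ⊈ B)
  unfilled? B i = ¬? (C i ⊆? B)

  Unfilled : Subset (n G) → Subset ℓ
  Unfilled B = select (unfilled? B)

  force-fills-clique : ∀ {B u w i} → CanForce G B u w → u ∈ C i → w ∈ C i →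
                       C i ⊆ ⁅ w ⁆ ∪ B
  force-fills-clique {B} {u} {w} {i} (u∈B , w∉B , _ , onlyWhite) u∈ w∈ {x} x∈
    with x ≟ w | x ∈? B
  ... | yes refl | _ = x∈p∪q⁺ (inj₁ (x∈⁅x⁆ w))
  ... | no _ | yes x∈B = x∈p∪q⁺ (inj₂ x∈B)
  ... | no x≢w | no x∉B = ⊥-elim (x≢w (onlyWhite x x∉B ux (step (here w∉B) x∉B wx)))
    where
    ux : Adj G u x
    ux = clique i u x u∈ x∈ (λ { refl → x∉B u∈B })
    wx : Adj G w x
    wx = clique i w x w∈ x∈ (≢-sym x≢w)

  force-shrinks-Unfilled : ∀ {B u w} → CanForce G B u w → Unfilled (⁅ w ⁆ ∪ B) ⊂ Unfilled B
  force-shrinks-Unfilled {B} {u} {w} cf@(_ , w∉B , uw , _) with covers u w uw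
  ... | i , u∈ , w∈ =
    (λ j∈ → ∈select⁺ (unfilled? B) λ Cj⊆B →
       ∈select⁻ (unfilled? _) j∈ (λ x∈ → x∈p∪q⁺ (inj₂ (Cj⊆B x∈)))) ,
    i , ∈select⁺ (unfilled? B) (λ Ci⊆B → w∉B (Ci⊆B w∈)) ,
    (λ i∈ → ∈select⁻ (unfilled? _) i∈ (force-fills-clique cf u∈ w∈))

  forcing-bound : ∀ {B} → Forces G B → n G ≤ ∣ B ∣ + ∣ Unfilled B ∣
  forcing-bound {B} (done all∈B) = ℕ.≤-trans all⇒n≤∣B∣ (ℕ.m≤m+n _ _)
    where
    all⇒n≤∣B∣ : n G ≤ ∣ B ∣
    all⇒n≤∣B∣ = subst (_≤ ∣ B ∣) (∣⊤∣≡n (n G)) (p⊆q⇒∣p∣≤∣q∣ {p = ⊤} (λ {x} _ → all∈B x))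
  forcing-bound {B} (force u w cf rest) = begin
    n G                                       ≤⟨ forcing-bound rest ⟩
    ∣ ⁅ w ⁆ ∪ B ∣ + ∣ Unfilled (⁅ w ⁆ ∪ B) ∣  ≤⟨ ℕ.+-monoˡ-≤ _ (∣⁅x⁆∪p∣≤1+∣p∣ w B) ⟩
    suc ∣ B ∣ + ∣ Unfilled (⁅ w ⁆ ∪ B) ∣      ≡⟨ sym (ℕ.+-suc ∣ B ∣ _) ⟩
    ∣ B ∣ + suc ∣ Unfilled (⁅ w ⁆ ∪ B) ∣      ≤⟨ ℕ.+-monoʳ-≤ ∣ B ∣
                                                   (p⊂q⇒∣p∣<∣q∣ (force-shrinks-Unfilled cf)) ⟩
    ∣ B ∣ + ∣ Unfilled B ∣                    ∎
    where open ℕ.≤-Reasoning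

  pzf-lowerBound : ∀ S → IsPZFSet G S → n G ∸ ℓ ≤ ∣ S ∣
  pzf-lowerBound S forces = ℕ.m≤n+o⇒m∸n≤o (n G) ℓ (begin
    n G                    ≤⟨ forcing-bound forces ⟩
    ∣ S ∣ + ∣ Unfilled S ∣  ≤⟨ ℕ.+-monoʳ-≤ ∣ S ∣ (∣p∣≤n (Unfilled S)) ⟩
    ∣ S ∣ + ℓ               ≡⟨ ℕ.+-comm ∣ S ∣ ℓ ⟩
    ℓ + ∣ S ∣               ∎)
    where open ℕ.≤-Reasoning

  module Forcing (order : ForcingOrder G C) where
    open ForcingOrder order

    forced-injective : ∀ x y → forced x ≡ forced y → x ≡ y
    forced-injective x y eq with x ≟ y
    ... | yes x≡y = x≡y
    ... | no x≢y = ⊥-elim (ℕ.<-asym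
      (forced-later x y (≢-sym x≢y) (subst (_∈ C y) (sym eq) (forced∈ y)))
      (forced-later y x x≢y (subst (_∈ C x) eq (forced∈ x))))

    forcer-meets-forced⇒≡ : ∀ {x y m} → rank x ≤ rank y →
                            forcer x ∈ C m → forced y ∈ C m → y ≡ x
    forcer-meets-forced⇒≡ {x} {y} {m} x≤y fx∈ fy∈ with y ≟ x
    ... | yes y≡x = y≡x
    ... | no y≢x = ⊥-elim (ℕ.<⇒≱ ranky<rankx x≤y)
      where
      ranky<rankx : rank y < rank x
      ranky<rankx with m ≟ x | m ≟ y
      ... | yes refl | _ = forced-later y m (≢-sym y≢x) fy∈
      ... | no m≢x | yes refl = forcer-earlier x m m≢x fx∈
      ... | no m≢x | no m≢y =
        ℕ.<-trans (forced-later y m m≢y fy∈) (forcer-earlier x m m≢x fx∈)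

    Unforced : Subset (n G)
    Unforced = ∁ (image forced)

    ∣Unforced∣≤n∸ℓ : ∣ Unforced ∣ ≤ n G ∸ ℓ
    ∣Unforced∣≤n∸ℓ rewrite ∣∁p∣≡n∸∣p∣ (image forced) =
      ℕ.∸-monoʳ-≤ (n G) (injective⇒≤∣image∣ forced forced-injective)

    record RankClosed (B : Subset (n G)) : Set where
      field
        Unforced⊆ : Unforced ⊆ B
        downward : ∀ x y → forced x ∈ B → rank y < rank x → forced y ∈ B

    module _ {B : Subset (n G)} (closed : RankClosed B) (x : Fin ℓ)
             (below∈B : ∀ y → rank y < rank x → forced y ∈ B) where
      open RankClosed closed

      white⇒forced-above : ∀ {w} → w ∉ B → ∃[ y ] (w ≡ forced y × rank x ≤ rank y)
      white⇒forced-above {w} w∉B with ∈image⁻ forced (x∉∁p⇒x∈p (λ w∈ → w∉B (Unforced⊆ w∈)))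
      ... | y , refl = y , refl , ℕ.≮⇒≥ (λ y<x → w∉B (below∈B y y<x))

      forcer∈B : forcer x ∈ B
      forcer∈B = decidable-stable (forcer x ∈? B) λ fx∉B →
        let y , fx≡fy , x≤y = white⇒forced-above fx∉B in
        forcer≢forced x (subst (λ v → forcer x ≡ forced v)
          (forcer-meets-forced⇒≡ x≤y (forcer∈ x) (subst (_∈ C x) fx≡fy (forcer∈ x))) fx≡fy)

      forcer-forces : forced x ∉ B → CanForce G B (forcer x) (forced x)
      forcer-forces fx∉B =
        forcer∈B , fx∉B , clique x _ _ (forcer∈ x) (forced∈ x) (forcer≢forced x) , onlyWhite
        where
        onlyWhite : ∀ w → w ∉ B → Adj G (forcer x) w → WhiteConn G B (forced x) w → w ≡ forced x
        onlyWhite w w∉B fx~w _ with white⇒forced-above w∉B | covers (forcer x) w fx~w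
        ... | y , refl , x≤y | m , fx∈ , fy∈ = cong forced (forcer-meets-forced⇒≡ x≤y fx∈ fy∈)

      closed-after-force : RankClosed (⁅ forced x ⁆ ∪ B)
      closed-after-force = record
        { Unforced⊆ = λ v∈ → x∈p∪q⁺ (inj₂ (Unforced⊆ v∈)) ; downward = downward′ }
        where
        downward′ : ∀ z y → forced z ∈ ⁅ forced x ⁆ ∪ B → rank y < rank z →
                    forced y ∈ ⁅ forced x ⁆ ∪ B
        downward′ z y fz∈ y<z with x∈p∪q⁻ _ _ fz∈
        ... | inj₂ fz∈B = x∈p∪q⁺ (inj₂ (downward z y fz∈B y<z))
        ... | inj₁ fz∈⁅fx⁆ with forced-injective z x (x∈⁅y⁆⇒x≡y _ fz∈⁅fx⁆)
        ...   | refl = x∈p∪q⁺ (inj₂ (below∈B y y<z))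

    forces-from : ∀ B → Acc _⊃_ B → RankClosed B → Forces G B
    forces-from B (acc smaller) closed with all? (_∈? B)
    ... | yes all∈B = done all∈B
    ... | no ¬all∈B with Fin.¬∀⟶∃¬ (n G) (_∈ B) (_∈? B) ¬all∈B
    ...   | v , v∉B with ∈image⁻ forced (x∉∁p⇒x∈p (λ v∈ → v∉B (RankClosed.Unforced⊆ closed v∈)))
    ...     | x₀ , refl with ∃-minimal (λ y → ¬? (forced y ∈? B)) rank (x₀ , v∉B)
    ...       | x , fx∉B , minimal =
      force (forcer x) (forced x) (forcer-forces closed x below∈B fx∉B)
        (forces-from _ (smaller (x∉p⇒p⊂⁅x⁆∪p fx∉B)) (closed-after-force closed x below∈B))
      where
      below∈B : ∀ y → rank y < rank x → forced y ∈ B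
      below∈B y y<x = decidable-stable (forced y ∈? B) (minimal y y<x)

    Unforced-forces : IsPZFSet G Unforced
    Unforced-forces = forces-from Unforced (⊃-wellFounded Unforced) record
      { Unforced⊆ = λ v∈ → v∈
      ; downward = λ x _ fx∈ _ → ⊥-elim (x∈∁p⇒x∉p fx∈ (∈image⁺ forced x))
      }

-- The clique intersection graph

module CliqueIntersection (G : Graph) {ℓ : ℕ} (C : Fin ℓ → Subset (n G)) where

  Meets : Fin ℓ → Fin ℓ → Set
  Meets x y = x ≢ y × ∃[ v ] (v ∈ C x × v ∈ C y)

  Meets? : ∀ x y → Dec (Meets x y)
  Meets? x y = ¬? (x ≟ y) ×-dec any? (λ v → (v ∈? C x) ×-dec (v ∈? C y))

  Meets-sym : ∀ {x y} → Meets x y → Meets y x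
  Meets-sym (x≢y , v , v∈x , v∈y) = ≢-sym x≢y , v , v∈y , v∈x

  Private : Fin ℓ → Fin (n G) → Set
  Private x v = v ∈ C x × (∀ m → m ≢ x → v ∉ C m)

  HasPrivate : Fin ℓ → Set
  HasPrivate x = ∃ (Private x)

  HasPrivate? : ∀ x → Dec (HasPrivate x)
  HasPrivate? x = any? (λ v → (v ∈? C x) ×-dec all? (λ m → ¬? (m ≟ x) →-dec ¬? (v ∈? C m)))

  pair : Fin ℓ → Fin ℓ → Fin ℓ × Fin ℓ
  pair x y with toℕ x ℕ.≤? toℕ y
  ... | yes _ = x , y
  ... | no _ = y , x

  _∈ₚ_ : Fin ℓ → Fin ℓ × Fin ℓ → Set
  z ∈ₚ (i , j) = z ≡ i ⊎ z ≡ j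

  ∈pair⁻ : ∀ {z} x y → z ∈ₚ pair x y → z ≡ x ⊎ z ≡ y
  ∈pair⁻ x y z∈ with toℕ x ℕ.≤? toℕ y
  ... | yes _ = z∈
  ... | no _ = [ inj₂ , inj₁ ]′ z∈

  ∈pair⁺ : ∀ {z} x y → z ≡ x ⊎ z ≡ y → z ∈ₚ pair x y
  ∈pair⁺ x y z∈ with toℕ x ℕ.≤? toℕ y
  ... | yes _ = z∈
  ... | no _ = [ inj₂ , inj₁ ]′ z∈

  Meets⇒IsCVertex : ∀ {x y} → Meets x y → IsCVertex G C (pair x y)
  Meets⇒IsCVertex {x} {y} (x≢y , v , v∈x , v∈y) with toℕ x ℕ.≤? toℕ y
  ... | yes x≤y = x≤y , v , (λ x≡y → ⊥-elim (x≢y x≡y)) , (λ _ → v∈x , v∈y)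
  ... | no x≰y = ℕ.≰⇒≥ x≰y , v , (λ y≡x → ⊥-elim (x≢y (sym y≡x))) , (λ _ → v∈y , v∈x)

  shares⇒∈ₚ : ∀ {i j i′ j′ : Fin ℓ} → (i ≡ i′ ⊎ i ≡ j′ ⊎ j ≡ i′ ⊎ j ≡ j′) →
              ∃[ z ] (z ∈ₚ (i , j) × z ∈ₚ (i′ , j′))
  shares⇒∈ₚ (inj₁ e) = _ , inj₁ refl , inj₁ e
  shares⇒∈ₚ (inj₂ (inj₁ e)) = _ , inj₁ refl , inj₂ e
  shares⇒∈ₚ (inj₂ (inj₂ (inj₁ e))) = _ , inj₂ refl , inj₁ e
  shares⇒∈ₚ (inj₂ (inj₂ (inj₂ e))) = _ , inj₂ refl , inj₂ e

  ∈ₚ⇒shares : ∀ {i j i′ j′ z : Fin ℓ} → z ∈ₚ (i , j) → z ∈ₚ (i′ , j′) →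
              (i ≡ i′ ⊎ i ≡ j′ ⊎ j ≡ i′ ⊎ j ≡ j′)
  ∈ₚ⇒shares (inj₁ refl) (inj₁ refl) = inj₁ refl
  ∈ₚ⇒shares (inj₁ refl) (inj₂ refl) = inj₂ (inj₁ refl)
  ∈ₚ⇒shares (inj₂ refl) (inj₁ refl) = inj₂ (inj₂ (inj₁ refl))
  ∈ₚ⇒shares (inj₂ refl) (inj₂ refl) = inj₂ (inj₂ (inj₂ refl))

  -- A cycle of meeting cliques gives an induced cycle of 𝒞(G): its line graph.
  module LineCycle {t} (c : Fin (3 + t) → Fin ℓ) (c-injective : ∀ a b → c a ≡ c b → a ≡ b)
                   (c-meets : ∀ a → Meets (c a) (c (next a))) where

    edge : Fin (3 + t) → Fin ℓ × Fin ℓ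
    edge a = pair (c a) (c (next a))

    ∈edge⁻ : ∀ {z} a → z ∈ₚ edge a → z ≡ c a ⊎ z ≡ c (next a)
    ∈edge⁻ a = ∈pair⁻ (c a) (c (next a))

    ∈edge⁺ : ∀ {z} a → z ≡ c a ⊎ z ≡ c (next a) → z ∈ₚ edge a
    ∈edge⁺ a = ∈pair⁺ (c a) (c (next a))

    edge-injective : ∀ a b → edge a ≡ edge b → a ≡ b
    edge-injective a b eq with ∈edge⁻ b (subst (c a ∈ₚ_) eq (∈edge⁺ a (inj₁ refl)))
                             | ∈edge⁻ b (subst (c (next a) ∈ₚ_) eq (∈edge⁺ a (inj₂ refl)))
    ... | inj₁ ca≡cb | _ = c-injective a b ca≡cb
    ... | _ | inj₂ cna≡cnb = next-injective (c-injective _ _ cna≡cnb)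
    ... | inj₂ ca≡cnb | inj₁ cna≡cb = ⊥-elim (next²-≢ b
      (trans (cong next (sym (c-injective _ _ ca≡cnb))) (c-injective _ _ cna≡cb)))

    edge-adjacent : ∀ a b → CAdj (edge a) (edge b) ⇔ CycleAdj (3 + t) a b
    edge-adjacent a b = mk⇔ to from
      where
      differ : ¬ (proj₁ (edge a) ≡ proj₁ (edge b) × proj₂ (edge a) ≡ proj₂ (edge b)) → a ≢ b
      differ ≢edge refl = ≢edge (refl , refl)
      to : CAdj (edge a) (edge b) → CycleAdj (3 + t) a b
      to (≢edge , shares) with shares⇒∈ₚ shares
      ... | z , z∈a , z∈b with ∈edge⁻ a z∈a | ∈edge⁻ b z∈b
      ...   | inj₁ refl | inj₁ ca≡cb = ⊥-elim (differ ≢edge (c-injective _ _ ca≡cb))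
      ...   | inj₂ refl | inj₂ cna≡cnb =
        ⊥-elim (differ ≢edge (next-injective (c-injective _ _ cna≡cnb)))
      ...   | inj₁ refl | inj₂ ca≡cnb =
        Equivalence.from (CycleAdj⇔next a b) (inj₂ (c-injective _ _ ca≡cnb))
      ...   | inj₂ refl | inj₁ cna≡cb =
        Equivalence.from (CycleAdj⇔next a b) (inj₁ (c-injective _ _ (sym cna≡cb)))
      from : CycleAdj (3 + t) a b → CAdj (edge a) (edge b)
      from adjacent with Equivalence.to (CycleAdj⇔next a b) adjacent
      ... | inj₁ refl =
        (λ (e₁ , e₂) → next-≢ a (sym (edge-injective a (next a) (cong₂ _,_ e₁ e₂)))) ,
        ∈ₚ⇒shares (∈edge⁺ a (inj₂ refl)) (∈edge⁺ b (inj₁ refl))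
      ... | inj₂ refl =
        (λ (e₁ , e₂) → next-≢ b (edge-injective (next b) b (cong₂ _,_ e₁ e₂))) ,
        ∈ₚ⇒shares (∈edge⁺ a (inj₁ refl)) (∈edge⁺ b (inj₂ refl))

    inducedCycle : InducedCycle (IsCVertex G C) CAdj (3 + t)
    inducedCycle = edge , (λ a → Meets⇒IsCVertex (c-meets a)) , edge-injective , edge-adjacent

  NoLongCycle : Set
  NoLongCycle = ∀ t (c : Fin (4 + t) → Fin ℓ) → (∀ a b → c a ≡ c b → a ≡ b) →
                ¬ (∀ a → Meets (c a) (c (next a)))

  noLongCycle : NoInducedCycleExceptK3 (IsCVertex G C) CAdj → NoLongCycle
  noLongCycle noInduced t c c-injective c-meets =
    noInduced (4 + t) (ℕ.m≤m+n 4 t) (LineCycle.inducedCycle c c-injective c-meets)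

  data Walk (R : Subset ℓ) : Fin ℓ → Fin ℓ → Set where
    [_] : ∀ {a} → a ∈ R → Walk R a a
    _∷⟨_⟩_ : ∀ {a b c} → a ∈ R → Meets a b → Walk R b c → Walk R a c

  head∈ : ∀ {R a c} → Walk R a c → a ∈ R
  head∈ [ a∈ ] = a∈
  head∈ (a∈ ∷⟨ _ ⟩ _) = a∈

  _++ʷ_ : ∀ {R a b c} → Walk R a b → Walk R b c → Walk R a c
  [ _ ] ++ʷ w′ = w′
  (a∈ ∷⟨ ab ⟩ w) ++ʷ w′ = a∈ ∷⟨ ab ⟩ (w ++ʷ w′)

  reverseʷ : ∀ {R a c} → Walk R a c → Walk R c a
  reverseʷ [ a∈ ] = [ a∈ ]
  reverseʷ (a∈ ∷⟨ ab ⟩ w) = reverseʷ w ++ʷ (head∈ w ∷⟨ Meets-sym ab ⟩ [ a∈ ])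

  penultimate : ∀ {R a c} → Walk R a c → a ≢ c → ∃[ z ] (z ∈ R × Meets z c)
  penultimate [ _ ] a≢c = ⊥-elim (a≢c refl)
  penultimate {c = c} (_∷⟨_⟩_ {b = b} a∈ ab w) a≢c with b ≟ c
  ... | yes refl = _ , a∈ , ab
  ... | no b≢c = penultimate w b≢c

  Simplicial : Subset ℓ → Fin ℓ → Set
  Simplicial R x = ∀ {a b} → a ∈ R → b ∈ R → Meets x a → Meets x b → a ≡ b ⊎ Meets a b

  -- A walk through a simplicial x can shortcut x through its two neighbours on the walk.
  module _ {R x} (simplicial : Simplicial R x) where
    mutual
      avoid : ∀ {a c} → Walk R a c → a ≢ x → c ≢ x → Walk (R - x) a c
      avoid [ a∈ ] a≢x _ = [ x∈p∧x≢y⇒x∈p-y a∈ a≢x ]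
      avoid (_∷⟨_⟩_ {b = b} a∈ ab w) a≢x c≢x with b ≟ x
      ... | no b≢x = x∈p∧x≢y⇒x∈p-y a∈ a≢x ∷⟨ ab ⟩ avoid w b≢x c≢x
      ... | yes refl = bypass a∈ ab w a≢x c≢x

      bypass : ∀ {a c} → a ∈ R → Meets a x → Walk R x c → a ≢ x → c ≢ x → Walk (R - x) a c
      bypass _ _ [ _ ] _ c≢x = ⊥-elim (c≢x refl)
      bypass a∈ ax (_ ∷⟨ xb ⟩ w) a≢x c≢x with simplicial a∈ (head∈ w) (Meets-sym ax) xb
      ... | inj₁ refl = avoid w a≢x c≢x
      ... | inj₂ ab = x∈p∧x≢y⇒x∈p-y a∈ a≢x ∷⟨ ab ⟩ avoid w (≢-sym (proj₁ xb)) c≢x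

  record Path (R : Subset ℓ) (len : ℕ) : Set where
    field
      vertex : Fin (suc len) → Fin ℓ
      vertex∈ : ∀ a → vertex a ∈ R
      vertex-injective : ∀ a b → vertex a ≡ vertex b → a ≡ b
      linked : ∀ a b → suc (toℕ a) ≡ toℕ b → Meets (vertex a) (vertex b)

    start end : Fin ℓ
    start = vertex zero
    end = vertex (fromℕ len)

  open Path

  singleton : ∀ {R r} → r ∈ R → Path R 0
  singleton {r = r} r∈ = record
    { vertex = λ _ → r
    ; vertex∈ = λ _ → r∈
    ; vertex-injective = λ { zero zero _ → refl }
    ; linked = λ { zero zero () }
    }

  prepend : ∀ {R len y} (P : Path R len) → y ∈ R → Meets y (start P) → (∀ a → vertex P a ≢ y) →
            Path R (suc len)
  prepend {R} {len} {y} P y∈ y~start fresh = record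
    { vertex = vertex′
    ; vertex∈ = λ { zero → y∈ ; (suc a) → vertex∈ P a }
    ; vertex-injective = injective′
    ; linked = linked′
    }
    where
    vertex′ : Fin (2 + len) → Fin ℓ
    vertex′ zero = y
    vertex′ (suc a) = vertex P a
    injective′ : ∀ a b → vertex′ a ≡ vertex′ b → a ≡ b
    injective′ zero zero _ = refl
    injective′ zero (suc b) eq = ⊥-elim (fresh b (sym eq))
    injective′ (suc a) zero eq = ⊥-elim (fresh a eq)
    injective′ (suc a) (suc b) eq = cong suc (vertex-injective P a b eq)
    linked′ : ∀ a b → suc (toℕ a) ≡ toℕ b → Meets (vertex′ a) (vertex′ b)
    linked′ zero (suc b) eq
      rewrite Fin.toℕ-injective {i = b} {j = zero} (sym (ℕ.suc-injective eq)) = y~start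
    linked′ (suc a) (suc b) eq = linked P a b (ℕ.suc-injective eq)

  pathWalk : ∀ {R len} (P : Path R len) → Walk R (start P) (end P)
  pathWalk {len = zero} P = [ vertex∈ P zero ]
  pathWalk {len = suc len} P =
    vertex∈ P zero ∷⟨ linked P zero (suc zero) refl ⟩ pathWalk tail
    where
    tail : Path _ len
    tail = record
      { vertex = λ a → vertex P (suc a)
      ; vertex∈ = λ a → vertex∈ P (suc a)
      ; vertex-injective = λ a b eq → Fin.suc-injective (vertex-injective P _ _ eq)
      ; linked = λ a b eq → linked P (suc a) (suc b) (cong suc eq)
      }

  -- The initial segment of P up to a chord closes a cycle of length at least 4.
  chordless : NoLongCycle → ∀ {R len} (P : Path R (2 + len)) (a : Fin len) →
              ¬ Meets (vertex P (suc (suc (suc a)))) (start P)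
  chordless noLong {len = len} P a chord = noLong (toℕ a) c c-injective c-meets
    where
    le : 4 + toℕ a ≤ 3 + len
    le = ℕ.+-monoʳ-≤ 3 (Fin.toℕ<n a)
    c : Fin (4 + toℕ a) → Fin _
    c b = vertex P (inject≤ b le)
    c-injective : ∀ b b′ → c b ≡ c b′ → b ≡ b′
    c-injective b b′ eq = Fin.toℕ-injective (trans (sym (Fin.toℕ-inject≤ b le))
      (trans (cong toℕ (vertex-injective P _ _ eq)) (Fin.toℕ-inject≤ b′ le)))
    c-meets : ∀ b → Meets (c b) (c (next b))
    c-meets b with IsNext-next b
    ... | inj₁ e = linked P _ _
      (trans (cong suc (Fin.toℕ-inject≤ b le)) (trans e (sym (Fin.toℕ-inject≤ (next b) le))))
    ... | inj₂ (e₀ , e) = subst₂ (λ i j → Meets (vertex P i) (vertex P j))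
      (sym (Fin.toℕ-injective (trans (Fin.toℕ-inject≤ b le) (ℕ.suc-injective e))))
      (sym (Fin.toℕ-injective {j = zero} (trans (Fin.toℕ-inject≤ (next b) le) e₀)))
      chord

  record MaximalPath (R : Subset ℓ) (r : Fin ℓ) : Set where
    field
      len : ℕ
      path : Path R (suc len)
      ends-at : end path ≡ r
      maximal : ∀ y → y ∈ R → Meets (start path) y → ∃[ a ] (vertex path a ≡ y)

  extendMaximally : ∀ {R len} (P : Path R (suc len)) → MaximalPath R (end P)
  extendMaximally {R} {len} P = go ℓ P (ℕ.m≤m+n ℓ len)
    where
    go : ∀ {len} fuel (P : Path R (suc len)) → ℓ ≤ fuel + len → MaximalPath R (end P)
    go {len} fuel P bound
      with any? (λ y → (y ∈? R) ×-dec Meets? (start P) y ×-dec all? (λ a → ¬? (vertex P a ≟ y)))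
    ... | no unextendable = record
      { len = len ; path = P ; ends-at = refl
      ; maximal = λ y y∈ start~y → decidable-stable (any? (λ a → vertex P a ≟ y))
          (λ absent → unextendable (y , y∈ , start~y , λ a eq → absent (a , eq)))
      }
    ... | yes (y , y∈ , start~y , fresh) = grow fuel bound
      where
      P′ : Path R (2 + len)
      P′ = prepend P y∈ (Meets-sym start~y) fresh
      grow : ∀ fuel → ℓ ≤ fuel + len → MaximalPath R (end P)
      grow zero bound = ⊥-elim (ℕ.1+n≰n (ℕ.≤-trans (ℕ.m≤n+m (suc len) 2)
        (ℕ.≤-trans (Fin.injective⇒≤ (vertex-injective P′ _ _)) bound)))
      grow (suc fuel′) bound = go fuel′ P′ (subst (ℓ ≤_) (sym (ℕ.+-suc fuel′ len)) bound)

  maximalPathTo : ∀ {R r y} → r ∈ R → y ∈ R → Meets r y → MaximalPath R r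
  maximalPathTo r∈R y∈R r~y =
    extendMaximally (prepend (singleton r∈R) y∈R (Meets-sym r~y) (λ _ → proj₁ r~y))

  record Endpoint (R : Subset ℓ) (x : Fin ℓ) : Set where
    field
      z₁ z₂ : Fin ℓ
      z₁∈R : z₁ ∈ R
      x~z₁ : Meets x z₁
      z₁≈z₂ : z₁ ≡ z₂ ⊎ Meets z₁ z₂
      neighbours : ∀ y → y ∈ R → Meets x y → y ≡ z₁ ⊎ y ≡ z₂

    simplicial : Simplicial R x
    simplicial a∈ b∈ x~a x~b with neighbours _ a∈ x~a | neighbours _ b∈ x~b | z₁≈z₂
    ... | inj₁ refl | inj₁ refl | _ = inj₁ refl
    ... | inj₂ refl | inj₂ refl | _ = inj₁ refl
    ... | inj₁ refl | inj₂ refl | inj₁ z₁≡z₂ = inj₁ z₁≡z₂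
    ... | inj₁ refl | inj₂ refl | inj₂ z₁~z₂ = inj₂ z₁~z₂
    ... | inj₂ refl | inj₁ refl | inj₁ z₁≡z₂ = inj₁ (sym z₁≡z₂)
    ... | inj₂ refl | inj₁ refl | inj₂ z₁~z₂ = inj₂ (Meets-sym z₁~z₂)

  -- The start of a maximal path meets only its two successors on the path: any later
  -- neighbour would close a long cycle.
  maximalPath-endpoint : NoLongCycle → ∀ {R r} (M : MaximalPath R r) →
                         Endpoint R (start (MaximalPath.path M))
  maximalPath-endpoint noLong M with MaximalPath.len M | MaximalPath.path M | MaximalPath.maximal M
  ... | zero | P | maximal = record
    { z₁ = vertex P (suc zero) ; z₂ = vertex P (suc zero) ; z₁∈R = vertex∈ P (suc zero)
    ; x~z₁ = linked P zero (suc zero) refl ; z₁≈z₂ = inj₁ refl ; neighbours = neighbours }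
    where
    neighbours : ∀ y → y ∈ _ → Meets (start P) y → y ≡ vertex P (suc zero) ⊎ y ≡ vertex P (suc zero)
    neighbours y y∈ start~y with maximal y y∈ start~y
    ... | zero , refl = ⊥-elim (proj₁ start~y refl)
    ... | suc zero , refl = inj₁ refl
  ... | suc len | P | maximal = record
    { z₁ = vertex P (suc zero) ; z₂ = vertex P (suc (suc zero)) ; z₁∈R = vertex∈ P (suc zero)
    ; x~z₁ = linked P zero (suc zero) refl
    ; z₁≈z₂ = inj₂ (linked P (suc zero) (suc (suc zero)) refl)
    ; neighbours = neighbours }
    where
    neighbours : ∀ y → y ∈ _ → Meets (start P) y →
                 y ≡ vertex P (suc zero) ⊎ y ≡ vertex P (suc (suc zero))
    neighbours y y∈ start~y with maximal y y∈ start~y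
    ... | zero , refl = ⊥-elim (proj₁ start~y refl)
    ... | suc zero , refl = inj₁ refl
    ... | suc (suc zero) , refl = inj₂ refl
    ... | suc (suc (suc a)) , refl = ⊥-elim (chordless noLong P a (Meets-sym start~y))

  module Peeling (simple : SimpleIntersection G C) (noLong : NoLongCycle)
                 (two-vertices : ∀ x → ∃[ u ] ∃[ v ] (u ∈ C x × v ∈ C x × u ≢ v))
                 (leaf-private : ∀ {x a b} → Meets x a → (∀ y → Meets x y → y ≡ a ⊎ y ≡ b) →
                                 a ≡ b ⊎ Meets a b → HasPrivate x) where

    other-clique-unique : ∀ {v x z m} → v ∈ C x → v ∈ C z → x ≢ z → m ≢ x → v ∈ C m → m ≡ z
    other-clique-unique {v} {x} {z} {m} v∈x v∈z x≢z m≢x v∈m with m ≟ z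
    ... | yes m≡z = m≡z
    ... | no m≢z = ⊥-elim (simple v x z m x≢z (≢-sym m≢z) (≢-sym m≢x) v∈x v∈z v∈m)

    other-vertex : ∀ x p → ∃[ u ] (u ∈ C x × u ≢ p)
    other-vertex x p with two-vertices x
    ... | u , v , u∈ , v∈ , u≢v with u ≟ p
    ...   | yes refl = v , v∈ , ≢-sym u≢v
    ...   | no u≢p = u , u∈ , u≢p

    meets-none : ∀ {R x} → ¬ (∃[ y ] (y ∈ R × Meets x y)) → ¬ (∃[ y ] (y ∉ R × Meets x y)) →
                 ∀ y → ¬ Meets x y
    meets-none {R} none-inside none-outside y x~y with y ∈? R
    ... | yes y∈R = none-inside (y , y∈R , x~y)
    ... | no y∉R = none-outside (y , y∉R , x~y)

    isolated-private : ∀ {x} → (∀ y → ¬ Meets x y) → HasPrivate x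
    isolated-private {x} isolated with two-vertices x
    ... | v , _ , v∈x , _ = v , v∈x , λ m m≢x v∈m → isolated m (≢-sym m≢x , v , v∈x , v∈m)

    Anchored : Subset ℓ → Set
    Anchored R = ∀ x → x ∈ R → ∃[ r ] (r ∈ R × HasPrivate r × Walk R x r)

    removeAnchored : ∀ {R x} → Simplicial R x → Anchored R →
      (∀ y → y ∈ R → y ≢ x → Walk R y x → ∃[ r ] (r ∈ R × r ≢ x × HasPrivate r × Walk R y r)) →
      Anchored (R - x)
    removeAnchored {R} {x} simplicial anchored redirect y y∈ with x∈p-y⇒x≢y y∈
    ... | y≢x with anchored y (x∈p-y⇒x∈p y∈)
    ...   | r , r∈R , r-private , y⇝r with r ≟ x
    ...     | no r≢x = r , x∈p∧x≢y⇒x∈p-y r∈R r≢x , r-private , avoid simplicial y⇝r y≢x r≢x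
    ...     | yes refl with redirect y (x∈p-y⇒x∈p y∈) y≢x y⇝r
    ...       | r′ , r′∈R , r′≢x , r′-private , y⇝r′ =
      r′ , x∈p∧x≢y⇒x∈p-y r′∈R r′≢x , r′-private , avoid simplicial y⇝r′ y≢x r′≢x

    record ForcerFor (R : Subset ℓ) (x : Fin ℓ) (e : Fin (n G)) : Set where
      constructor forcerFor
      field
        forcer : Fin (n G)
        forcer∈ : forcer ∈ C x
        forcer≢forced : forcer ≢ e
        forcer-outside : ∀ m → m ≢ x → forcer ∈ C m → m ∉ R

    -- A vertex shared with a clique outside R lies in no other clique of R.
    forcerFor-outside : ∀ {R x e} → (∀ m → m ≢ x → e ∈ C m → m ∈ R) →
                        (¬ (∃[ y ] (y ∉ R × Meets x y)) → ForcerFor R x e) → ForcerFor R x e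
    forcerFor-outside {R} {x} e-inside fallback with any? (λ y → ¬? (y ∈? R) ×-dec Meets? x y)
    ... | no none-outside = fallback none-outside
    ... | yes (y , y∉R , x≢y , v , v∈x , v∈y) = forcerFor v v∈x
      (λ { refl → y∉R (e-inside y (≢-sym x≢y) v∈y) })
      (λ m m≢x v∈m → subst (_∉ R) (sym (other-clique-unique v∈x v∈y x≢y m≢x v∈m)) y∉R)

    record PeelStep (R : Subset ℓ) : Set where
      field
        x : Fin ℓ
        x∈R : x ∈ R
        forced : Fin (n G)
        forced∈ : forced ∈ C x
        forced-inside : ∀ m → m ≢ x → forced ∈ C m → m ∈ R
        forcerChoice : ForcerFor R x forced
        anchored : Anchored (R - x)

    isolatedStep : ∀ {R r} → Anchored R → r ∈ R → HasPrivate r → ¬ (∃[ y ] (y ∈ R × Meets r y)) →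
                   PeelStep R
    isolatedStep {R} {r} anchored r∈R (p , p∈r , p-private) isolated = record
      { x = r ; x∈R = r∈R ; forced = p ; forced∈ = p∈r
      ; forced-inside = λ m m≢r p∈m → ⊥-elim (p-private m m≢r p∈m)
      ; forcerChoice = forcerFor-outside (λ m m≢r p∈m → ⊥-elim (p-private m m≢r p∈m)) fallback
      ; anchored = removeAnchored (λ a∈ _ r~a _ → ⊥-elim (isolated (_ , a∈ , r~a))) anchored
          λ y _ y≢r y⇝r → ⊥-elim (isolated (map₂ (map₂ Meets-sym) (penultimate y⇝r y≢r)))
      }
      where
      fallback : ¬ (∃[ y ] (y ∉ R × Meets r y)) → ForcerFor R r p
      fallback none-outside with other-vertex r p
      ... | u , u∈r , u≢p = forcerFor u u∈r u≢p λ m m≢r u∈m →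
        ⊥-elim (meets-none isolated none-outside m (≢-sym m≢r , u , u∈r , u∈m))

    pathStep : ∀ {R r y} → Anchored R → r ∈ R → HasPrivate r → y ∈ R → Meets r y → PeelStep R
    pathStep {R} {r} {y} anchored r∈R r-private y∈R r~y = record
      { x = x ; x∈R = vertex∈ P zero ; forced = e ; forced∈ = e∈x
      ; forced-inside = e-inside
      ; forcerChoice = forcerFor-outside e-inside fallback
      ; anchored = removeAnchored simplicial anchored redirect
      }
      where
      M : MaximalPath R r
      M = maximalPathTo r∈R y∈R r~y
      open MaximalPath M using (path; ends-at)
      P = path
      x = start P
      open Endpoint (maximalPath-endpoint noLong M)
      e : Fin (n G)
      e = proj₁ (proj₂ x~z₁)
      e∈x : e ∈ C x
      e∈x = proj₁ (proj₂ (proj₂ x~z₁))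
      e∈z₁ : e ∈ C z₁
      e∈z₁ = proj₂ (proj₂ (proj₂ x~z₁))
      e-inside : ∀ m → m ≢ x → e ∈ C m → m ∈ R
      e-inside m m≢x e∈m =
        subst (_∈ R) (sym (other-clique-unique e∈x e∈z₁ (proj₁ x~z₁) m≢x e∈m)) z₁∈R
      neighbours-inside : ¬ (∃[ y ] (y ∉ R × Meets x y)) → ∀ y → Meets x y → y ∈ R
      neighbours-inside none-outside y x~y =
        decidable-stable (y ∈? R) (λ y∉R → none-outside (y , y∉R , x~y))
      fallback : ¬ (∃[ y ] (y ∉ R × Meets x y)) → ForcerFor R x e
      fallback none-outside
        with leaf-private x~z₁ (λ y x~y → neighbours y (neighbours-inside none-outside y x~y) x~y)
                          z₁≈z₂
      ... | p , p∈x , p-private = forcerFor p p∈x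
        (λ { refl → p-private z₁ (≢-sym (proj₁ x~z₁)) e∈z₁ })
        (λ m m≢x p∈m → ⊥-elim (p-private m m≢x p∈m))
      r≢x : r ≢ x
      r≢x r≡x with vertex-injective P _ zero (trans ends-at r≡x)
      ... | ()
      redirect : ∀ y → y ∈ R → y ≢ x → Walk R y x →
                 ∃[ r′ ] (r′ ∈ R × r′ ≢ x × HasPrivate r′ × Walk R y r′)
      redirect y _ _ y⇝x =
        r , r∈R , r≢x , r-private , (y⇝x ++ʷ subst (Walk R x) ends-at (pathWalk P))

    peelStep : ∀ {R x₀} → Anchored R → x₀ ∈ R → PeelStep R
    peelStep {R} anchored x₀∈R with anchored _ x₀∈R
    ... | r , r∈R , r-private , _ with any? (λ y → (y ∈? R) ×-dec Meets? r y)
    ...   | yes (y , y∈R , r~y) = pathStep anchored r∈R r-private y∈R r~y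
    ...   | no isolated = isolatedStep anchored r∈R r-private isolated

    record Handles (R : Subset ℓ) (rank : Fin ℓ → ℕ) (x : Fin ℓ) : Set where
      field
        forced forcer : Fin (n G)
        forced∈ : forced ∈ C x
        forcer∈ : forcer ∈ C x
        forcer≢forced : forcer ≢ forced
        forced-later : ∀ m → m ≢ x → forced ∈ C m → m ∈ R × rank x < rank m
        forcer-earlier : ∀ m → m ≢ x → forcer ∈ C m → m ∉ R ⊎ rank m < rank x

    PeelOrder : Subset ℓ → Set
    PeelOrder R = Σ (Fin ℓ → ℕ) λ rank → ∀ x → x ∈ R → Handles R rank x

    putFirst : Fin ℓ → (Fin ℓ → ℕ) → Fin ℓ → ℕ
    putFirst x rank y with y ≟ x
    ... | yes _ = 0
    ... | no _ = suc (rank y)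

    putFirst-≢ : ∀ {x rank y} → y ≢ x → putFirst x rank y ≡ suc (rank y)
    putFirst-≢ {x} {y = y} y≢x with y ≟ x
    ... | yes y≡x = ⊥-elim (y≢x y≡x)
    ... | no _ = refl

    putFirst-self : ∀ {x rank} → putFirst x rank x ≡ 0
    putFirst-self {x} with x ≟ x
    ... | yes _ = refl
    ... | no x≢x = ⊥-elim (x≢x refl)

    putFirst-first : ∀ {x rank} y → y ≢ x → putFirst x rank x < putFirst x rank y
    putFirst-first {x} {rank} y y≢x
      rewrite putFirst-self {x} {rank} | putFirst-≢ {x} {rank} y≢x = s≤s z≤n

    peelOnce : ∀ {R} (S : PeelStep R) → PeelOrder (R - PeelStep.x S) → PeelOrder R
    peelOnce {R} S (rank , handles) = putFirst x rank , handles′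
      where
      open PeelStep S
      open ForcerFor forcerChoice
      handles′ : ∀ y → y ∈ R → Handles R (putFirst x rank) y
      handles′ y y∈R with y ≟ x
      ... | yes refl = record
        { forced = forced ; forcer = forcer ; forced∈ = forced∈ ; forcer∈ = forcer∈
        ; forcer≢forced = forcer≢forced
        ; forced-later = λ m m≢x e∈m → forced-inside m m≢x e∈m , putFirst-first m m≢x
        ; forcer-earlier = λ m m≢x u∈m → inj₁ (forcer-outside m m≢x u∈m)
        }
      ... | no y≢x = record
        { forced = H.forced ; forcer = H.forcer ; forced∈ = H.forced∈ ; forcer∈ = H.forcer∈
        ; forcer≢forced = H.forcer≢forced
        ; forced-later = later
        ; forcer-earlier = earlier
        }
        where
        module H = Handles (handles y (x∈p∧x≢y⇒x∈p-y y∈R y≢x))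
        later : ∀ m → m ≢ y → H.forced ∈ C m → m ∈ R × putFirst x rank y < putFirst x rank m
        later m m≢y e∈m with H.forced-later m m≢y e∈m
        ... | m∈ , y<m rewrite putFirst-≢ {x} {rank} y≢x | putFirst-≢ {x} {rank} (x∈p-y⇒x≢y m∈) =
          x∈p-y⇒x∈p m∈ , s≤s y<m
        earlier : ∀ m → m ≢ y → H.forcer ∈ C m → m ∉ R ⊎ putFirst x rank m < putFirst x rank y
        earlier m m≢y u∈m rewrite putFirst-≢ {x} {rank} y≢x with m ≟ x | H.forcer-earlier m m≢y u∈m
        ... | yes _ | _ = inj₂ (s≤s z≤n)
        ... | no _ | inj₂ m<y = inj₂ (s≤s m<y)
        ... | no m≢x | inj₁ m∉R-x = inj₁ (λ m∈R → m∉R-x (x∈p∧x≢y⇒x∈p-y m∈R m≢x))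

    peel : ∀ R → Acc _⊂_ R → Anchored R → PeelOrder R
    peel R (acc smaller) anchored with nonempty? R
    ... | no empty = (λ _ → 0) , λ x x∈R → ⊥-elim (empty (x , x∈R))
    ... | yes (_ , x₀∈R) = peelOnce S (peel _ (smaller (x∈p⇒p-x⊂p x∈R)) (PeelStep.anchored S))
      where
      S = peelStep anchored x₀∈R
      open PeelStep S using (x∈R)

    anchored-⊤ : Anchored ⊤
    anchored-⊤ x _ with any? (Meets? x)
    ... | no isolated = x , ∈⊤ , isolated-private (λ y x~y → isolated (y , x~y)) , [ ∈⊤ ]
    ... | yes (y , x~y) =
      start P , ∈⊤ , leaf-private x~z₁ (λ y x~y → neighbours y ∈⊤ x~y) z₁≈z₂ ,
      subst (λ r → Walk ⊤ r (start P)) ends-at (reverseʷ (pathWalk P))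
      where
      M : MaximalPath ⊤ x
      M = maximalPathTo ∈⊤ ∈⊤ x~y
      open MaximalPath M using (path; ends-at)
      P = path
      open Endpoint (maximalPath-endpoint noLong M)

    forcingOrder : ForcingOrder G C
    forcingOrder with peel ⊤ (⊂-wellFounded ⊤) anchored-⊤
    ... | rank , handles = record
      { rank = rank
      ; forced = H.forced
      ; forcer = H.forcer
      ; forced∈ = H.forced∈
      ; forcer∈ = H.forcer∈
      ; forcer≢forced = H.forcer≢forced
      ; forced-later = λ x m m≢x e∈m → proj₂ (H.forced-later x m m≢x e∈m)
      ; forcer-earlier = λ x m m≢x u∈m → [ (λ m∉⊤ → ⊥-elim (m∉⊤ ∈⊤)) , (λ m<x → m<x) ]′
          (H.forcer-earlier x m m≢x u∈m)
      }
      where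
      module H (x : Fin ℓ) = Handles (handles x ∈⊤)

-- Minimum clique coverings

Redundant : (G : Graph) {ℓ : ℕ} → (Fin ℓ → Subset (n G)) → Fin ℓ → Set
Redundant G C x = ∀ u v → u ∈ C x → v ∈ C x → Adj G u v → ∃[ i ] (i ≢ x × u ∈ C i × v ∈ C i)

dropClique : (G : Graph) {ℓ : ℕ} (C : Fin (suc ℓ) → Subset (n G)) → IsCliqueCovering G C →
             ∀ x → Redundant G C x → IsCliqueCovering G (λ i → C (punchIn x i))
dropClique G C (clique , covers) x redundant = (λ i → clique (punchIn x i)) , covers′
  where
  reindex : ∀ {u v j} → j ≢ x → u ∈ C j → v ∈ C j →
            ∃[ i ] (u ∈ C (punchIn x i) × v ∈ C (punchIn x i))
  reindex {u} {v} j≢x u∈j v∈j =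
    punchOut (≢-sym j≢x) , subst (λ k → u ∈ C k) (sym eq) u∈j , subst (λ k → v ∈ C k) (sym eq) v∈j
    where
    eq = Fin.punchIn-punchOut (≢-sym j≢x)
  covers′ : ∀ u v → Adj G u v → ∃[ i ] (u ∈ C (punchIn x i) × v ∈ C (punchIn x i))
  covers′ u v uv with covers u v uv
  ... | i , u∈i , v∈i with i ≟ x
  ...   | no i≢x = reindex i≢x u∈i v∈i
  ...   | yes refl with redundant u v u∈i v∈i uv
  ...     | j , j≢x , u∈j , v∈j = reindex j≢x u∈j v∈j

minimum⇒irredundant : (G : Graph) {ℓ : ℕ} (C : Fin ℓ → Subset (n G)) → IsCliqueCovering G C →
                      (∀ m (C′ : Fin m → Subset (n G)) → IsCliqueCovering G C′ → ℓ ≤ m) →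
                      ∀ x → ¬ Redundant G C x
minimum⇒irredundant G {suc ℓ} C covering minimum x redundant =
  ℕ.1+n≰n (minimum ℓ _ (dropClique G C covering x redundant))

module MinMaxCovering (G : Graph) {ℓ : ℕ} (C : Fin ℓ → Subset (n G))
                      (minmax : IsMinMaxCliqueCovering G C) (simple : SimpleIntersection G C) where
  open CliqueIntersection G C

  private
    clique : ∀ i → IsClique G (C i)
    clique = proj₁ (proj₁ minmax)

    maximal : ∀ i → IsMaximalClique G (C i)
    maximal = proj₂ (proj₂ minmax)

    irredundant : ∀ x → ¬ Redundant G C x
    irredundant = minimum⇒irredundant G C (proj₁ minmax) (proj₂ (proj₁ (proj₂ minmax)))

  two-vertices : ∀ x → ∃[ u ] ∃[ v ] (u ∈ C x × v ∈ C x × u ≢ v)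
  two-vertices x = decidable-stable
    (any? λ u → any? λ v → (u ∈? C x) ×-dec (v ∈? C x) ×-dec ¬? (u ≟ v))
    λ none → irredundant x λ u v u∈x v∈x uv → ⊥-elim (none (u , v , u∈x , v∈x , Adj⇒≢ G uv))

  leaf-private : ∀ {x a b} → Meets x a → (∀ y → Meets x y → y ≡ a ⊎ y ≡ b) →
                 a ≡ b ⊎ Meets a b → HasPrivate x
  leaf-private {x} {a} {b} x~a neighbours a≈b = decidable-stable (HasPrivate? x) no-private⇒⊥
    where
    module _ (no-private : ¬ HasPrivate x) where
      elsewhere : ∀ {v} → v ∈ C x → ∃[ m ] (Meets x m × v ∈ C m × (m ≡ a ⊎ m ≡ b))
      elsewhere {v} v∈x with decidable-stable (any? λ m → ¬? (m ≟ x) ×-dec (v ∈? C m))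
                               (λ none → no-private (v , v∈x , λ m m≢x v∈m → none (m , m≢x , v∈m)))
      ... | m , m≢x , v∈m = m , x~m , v∈m , neighbours m x~m
        where
        x~m = ≢-sym m≢x , v , v∈x , v∈m

      -- Without a private vertex, either C x ⊆ C a and x is redundant ...
      inside-a : a ≡ b ⊎ ¬ Meets x b → ∀ {v} → v ∈ C x → v ∈ C a
      inside-a a≈b v∈x with elsewhere v∈x | a≈b
      ... | _ , _ , v∈m , inj₁ refl | _ = v∈m
      ... | _ , _ , v∈m , inj₂ refl | inj₁ refl = v∈m
      ... | _ , x~m , _ , inj₂ refl | inj₂ ¬x~b = ⊥-elim (¬x~b x~m)

      redundant⇒⊥ : a ≡ b ⊎ ¬ Meets x b → ⊥
      redundant⇒⊥ a≈b = irredundant x λ u v u∈x v∈x _ →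
        a , ≢-sym (proj₁ x~a) , inside-a a≈b u∈x , inside-a a≈b v∈x

      -- ... or a vertex of C a ∩ C b extends the clique C x.
      triangle⇒⊥ : Meets a b → Meets x b → ⊥
      triangle⇒⊥ (a≢b , w , w∈a , w∈b) x~b =
        proj₂ (maximal x) w w∉x (clique-extend G (proj₁ (maximal x)) w~)
        where
        w∉x : w ∉ C x
        w∉x w∈x = simple w x a b (proj₁ x~a) a≢b (proj₁ x~b) w∈x w∈a w∈b
        w~ : ∀ q → q ∈ C x → q ≢ w → Adj G w q
        w~ q q∈x q≢w with elsewhere q∈x
        ... | _ , _ , q∈m , inj₁ refl = clique a w q w∈a q∈m (≢-sym q≢w)
        ... | _ , _ , q∈m , inj₂ refl = clique b w q w∈b q∈m (≢-sym q≢w)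

      no-private⇒⊥′ : a ≡ b ⊎ Meets a b → Dec (Meets x b) → ⊥
      no-private⇒⊥′ (inj₁ a≡b) _ = redundant⇒⊥ (inj₁ a≡b)
      no-private⇒⊥′ (inj₂ _) (no ¬x~b) = redundant⇒⊥ (inj₂ ¬x~b)
      no-private⇒⊥′ (inj₂ a~b) (yes x~b) = triangle⇒⊥ a~b x~b

      no-private⇒⊥ : ⊥
      no-private⇒⊥ = no-private⇒⊥′ a≈b (Meets? x b)

theorem11p2 : (G : Graph) (ℓ : ℕ) (C : Fin ℓ → Subset (n G)) →
    IsMinMaxCliqueCovering G C →
    SimpleIntersection G C →
    NoInducedCycleExceptK3 (IsCVertex G C) CAdj →
    IsPZFNumber G (n G ∸ ℓ)
theorem11p2 G ℓ C minmax simple noInduced =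
  (Unforced , Unforced-forces ,
   ℕ.≤-antisym ∣Unforced∣≤n∸ℓ (pzf-lowerBound Unforced Unforced-forces)) ,
  pzf-lowerBound
  where
  open CliqueCovering G C (proj₁ minmax)
  open CliqueIntersection G C
  open MinMaxCovering G C minmax simple
  open Forcing (Peeling.forcingOrder simple (noLongCycle noInduced) two-vertices leaf-private)
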